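{- Let $\mathcal L^P$ be a logic with set of atomic formulas $P$ and formula algebra $\mathfrak F^P$. Then for every homomorphism $h$ from $\mathfrak F^P$ into a member of $\mathrm{Alg}_m(\mathcal L^P)$, the kernel $\ker(h)$ is closed under $\vdash_{\mathcal L^P}$.
   Context: A logic is a tuple $\mathcal L=\langle F,M,\mathrm{mng},\models\rangle$ with connectives $\mathrm{Cn}$, atomic formulas $P$ (no $p\in P$ a proper term over $P\setminus\{p\}$), formula algebra $\mathfrak F=\mathfrak F(P,\mathrm{Cn})$ (term algebra, universe $F$), class $M$ of models, validity $\models\subseteq M\times F$, and homomorphisms $\mathrm{mng}_{\mathfrak M}$ from $\mathfrak F$ into algebras of type $\mathrm{Cn}$ (equal meanings preserve validity). $\mathrm{Alg}_m(\mathcal L)=\{\mathrm{mng}_{\mathfrak M}(\mathfrak F):\mathfrak M\in M\}$. For $H\subseteq F\times F$, $\tau,\sigma\in F$: $H\vdash_{\mathcal L}\langle\tau,\sigma\rangle$ iff for every endomorphism $f$ of $\mathfrak F$ and every $\mathfrak M\in M$, $f(H)\subseteq\ker(\mathrm{mng}_{\mathfrak M})$ implies $\langle f\tau,f\sigma\rangle\in\ker(\mathrm{mng}_{\mathfrak M})$, where $f(H)=\{\langle f\phi,f\psi\rangle:\langle\phi,\psi\rangle\in H\}$. A set $\Sigma\subseteq F\times F$ is closed under $\vdash$ if $H\subseteq\Sigma$ and $H\vdash\langle\tau,\sigma\rangle$ imply $\langle\tau,\sigma\rangle\in\Sigma$. -}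

module Defs where

open import Data.Nat using (ℕ)
open import Data.Vec using (Vec; map)
open import Data.Product using (_×_; _,_; Σ; ∃)
open import Relation.Binary.PropositionalEquality using (_≡_)

record Signature : Set₁ where
  field
    Cn    : Set
    arity : Cn → ℕ

module _ (S : Signature) where
  open Signature S

  -- Formula algebra 𝔉(P,Cn): the term algebra over atoms P.
  -- (Atoms and compound terms are distinct constructors, so no atom is a
  -- proper term over the other atoms.)
  data Formula (P : Set) : Set where
    atom : P → Formula P
    op   : (c : Cn) → Vec (Formula P) (arity c) → Formula P

  record Algebra : Set₁ where
    field
      Carrier : Set
      ⟦_⟧     : (c : Cn) → Vec Carrier (arity c) → Carrier

  open Algebra public

  IsHom : {P : Set} (A : Algebra) → (Formula P → Carrier A) → Set
  IsHom {P} A h = (c : Cn) (ts : Vec (Formula P) (arity c)) →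
                  h (op c ts) ≡ ⟦ A ⟧ c (map h ts)

  IsEndo : {P : Set} → (Formula P → Formula P) → Set
  IsEndo {P} f = (c : Cn) (ts : Vec (Formula P) (arity c)) →
                 f (op c ts) ≡ op c (map f ts)

  record Logic (P : Set) : Set₁ where
    field
      Model   : Set
      _⊨_     : Model → Formula P → Set
      alg     : Model → Algebra
      mng     : (𝔐 : Model) → Formula P → Carrier (alg 𝔐)
      mng-hom : (𝔐 : Model) → IsHom (alg 𝔐) (mng 𝔐)
      mng-⊨   : (𝔐 : Model) (φ ψ : Formula P) →
                mng 𝔐 φ ≡ mng 𝔐 ψ → 𝔐 ⊨ φ → 𝔐 ⊨ ψ

  Rel : Set → Set₁
  Rel P = Formula P × Formula P → Set

  ker : {P : Set} {B : Set} → (Formula P → B) → Rel P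
  ker h (φ , ψ) = h φ ≡ h ψ

  _⊢[_]_ : {P : Set} → Rel P → Logic P → Formula P × Formula P → Set
  _⊢[_]_ {P} H L (τ , σ) =
    (f : Formula P → Formula P) → IsEndo f → (𝔐 : Logic.Model L) →
    ((φ ψ : Formula P) → H (φ , ψ) → Logic.mng L 𝔐 (f φ) ≡ Logic.mng L 𝔐 (f ψ)) →
    Logic.mng L 𝔐 (f τ) ≡ Logic.mng L 𝔐 (f σ)

  ClosedUnder⊢ : {P : Set} → Logic P → Rel P → Set₁
  ClosedUnder⊢ {P} L Σ' = (H : Rel P) → (∀ φ ψ → H (φ , ψ) → Σ' (φ , ψ)) →
    (τ σ : Formula P) → H ⊢[ L ] (τ , σ) → Σ' (τ , σ)

  -- h is a homomorphism from 𝔉^P into mng_𝔐(𝔉) ∈ Alg_m(L): a homomorphism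
  -- into the algebra of 𝔐 whose values lie in the image subalgebra mng_𝔐(𝔉).
  HomIntoImage : {P : Set} (L : Logic P) (𝔐 : Logic.Model L) →
                 (Formula P → Carrier (Logic.alg L 𝔐)) → Set
  HomIntoImage {P} L 𝔐 h =
    IsHom (Logic.alg L 𝔐) h × ((φ : Formula P) → ∃ λ ψ → h φ ≡ Logic.mng L 𝔐 ψ)

-- Every element of mng_𝔐(𝔉) is the meaning of some formula, so h sends each
-- atom p to mng_𝔐(w p) for a chosen formula w p.  The substitution p ↦ w p
-- extends to an endomorphism f of 𝔉, and mng_𝔐 ∘ f and h are homomorphisms
-- agreeing on atoms, hence equal.  So ker h = ker (mng_𝔐 ∘ f), and a
-- consequence H ⊢ ⟨τ,σ⟩ of pairs in ker h, instantiated at f and 𝔐, lands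
-- in ker h again.
module Submission where

open import Defs
open import Data.Vec using (Vec; []; _∷_; map)
open import Data.Product using (_,_; proj₁; proj₂)
open import Relation.Binary.PropositionalEquality

module _ {S : Signature} {P : Set} where

  substitute : (P → Formula S P) → Formula S P → Formula S P
  substitute* : ∀ {n} → (P → Formula S P) → Vec (Formula S P) n → Vec (Formula S P) n
  substitute s (atom p)  = s p
  substitute s (op c ts) = op c (substitute* s ts)
  substitute* s []       = []
  substitute* s (t ∷ ts) = substitute s t ∷ substitute* s ts

  substitute*≡map : ∀ {n} (s : P → Formula S P) (ts : Vec (Formula S P) n) →
                    substitute* s ts ≡ map (substitute s) ts
  substitute*≡map s []       = refl
  substitute*≡map s (t ∷ ts) = cong (substitute s t ∷_) (substitute*≡map s ts)

  substitute-isEndo : (s : P → Formula S P) → IsEndo S (substitute s)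
  substitute-isEndo s c ts = cong (op c) (substitute*≡map s ts)

  module _ (A : Algebra S) where

    hom-∘-endo : {g : Formula S P → Carrier A} {f : Formula S P → Formula S P} →
                 IsHom S A g → IsEndo S f → IsHom S A (λ φ → g (f φ))
    hom-∘-endo {g} {f} g-hom f-endo c ts = begin
      g (f (op c ts))              ≡⟨ cong g (f-endo c ts) ⟩
      g (op c (map f ts))          ≡⟨ g-hom c (map f ts) ⟩
      ⟦ A ⟧ c (map g (map f ts))   ≡⟨ cong (⟦ A ⟧ c) (map-∘ ts) ⟩
      ⟦ A ⟧ c (map (λ φ → g (f φ)) ts) ∎
      where
      open ≡-Reasoning
      map-∘ : ∀ {n} (us : Vec (Formula S P) n) →
              map g (map f us) ≡ map (λ φ → g (f φ)) us
      map-∘ []       = refl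
      map-∘ (u ∷ us) = cong (g (f u) ∷_) (map-∘ us)

    hom-unique : {g k : Formula S P → Carrier A} → IsHom S A g → IsHom S A k →
                 (∀ p → g (atom p) ≡ k (atom p)) → ∀ φ → g φ ≡ k φ
    hom-unique {g} {k} g-hom k-hom agree = go
      where
      go : ∀ φ → g φ ≡ k φ
      go* : ∀ {n} (ts : Vec (Formula S P) n) → map g ts ≡ map k ts
      go (atom p)  = agree p
      go (op c ts) = begin
        g (op c ts)          ≡⟨ g-hom c ts ⟩
        ⟦ A ⟧ c (map g ts)   ≡⟨ cong (⟦ A ⟧ c) (go* ts) ⟩
        ⟦ A ⟧ c (map k ts)   ≡⟨ sym (k-hom c ts) ⟩
        k (op c ts)          ∎
        where open ≡-Reasoning
      go* []       = refl
      go* (t ∷ ts) = cong₂ _∷_ (go t) (go* ts)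

  module _ (L : Logic S P) where
    open Logic L

    ker-mng∘endo-closed : (𝔐 : Model) {f : Formula S P → Formula S P} → IsEndo S f →
                          ClosedUnder⊢ S L (ker S (λ φ → mng 𝔐 (f φ)))
    ker-mng∘endo-closed 𝔐 {f} f-endo H H⊆ker τ σ H⊢τσ = H⊢τσ f f-endo 𝔐 H⊆ker

    closedUnder⊢-resp-≗ : {B : Set} {g k : Formula S P → B} → (∀ φ → g φ ≡ k φ) →
                          ClosedUnder⊢ S L (ker S g) → ClosedUnder⊢ S L (ker S k)
    closedUnder⊢-resp-≗ g≗k g-closed H H⊆ker τ σ H⊢τσ =
      trans (sym (g≗k τ)) (trans (g-closed H H⊆kerg τ σ H⊢τσ) (g≗k σ))
      where
      H⊆kerg : ∀ φ ψ → H (φ , ψ) → ker S _ (φ , ψ)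
      H⊆kerg φ ψ Hφψ = trans (g≗k φ) (trans (H⊆ker φ ψ Hφψ) (sym (g≗k ψ)))

claim4p8 : (S : Signature) (P : Set) (L : Logic S P) (𝔐 : Logic.Model L)
    (h : Formula S P → Carrier (Logic.alg L 𝔐)) →
    HomIntoImage S L 𝔐 h → ClosedUnder⊢ S L (ker S h)
claim4p8 S P L 𝔐 h (h-hom , h-intoImage) =
  closedUnder⊢-resp-≗ L mng∘f≗h (ker-mng∘endo-closed L 𝔐 (substitute-isEndo w))
  where
  open Logic L
  w : P → Formula S P
  w p = proj₁ (h-intoImage (atom p))

  mng∘f≗h : ∀ φ → mng 𝔐 (substitute w φ) ≡ h φ
  mng∘f≗h = hom-unique (alg 𝔐) (hom-∘-endo (alg 𝔐) (mng-hom 𝔐) (substitute-isEndo w))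
                       h-hom (λ p → sym (proj₂ (h-intoImage (atom p))))
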